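{- Let $m$ and $n$ be positive integers with $n \geq 4$ even, let $0 \leq \ell \leq n-1$ be an integer of the same parity as $m$, and let $\Gamma = \mathrm{Cay}(G;\{t,tx,ty\})$ where $$G = \langle t,x,y \mid t^2,\ x^{n/2},\ y^m = x^{(\ell + m)/2},\ txt = x^{ -1},\ tyt = y^{ -1},\ xy = yx\rangle.$$ Color the edges of $\Gamma$ by letting $\mathcal{R} = \{\{g,gt\}: g\in G\}$ (red), $\mathcal{B} = \{\{g,gtx\}: g\in G\}$ (blue), $\mathcal{G} = \{\{g,gty\}: g\in G\}$ (green). If $\alpha \in \mathrm{Aut}(\Gamma)$ is such that there is no edge $e$ for which $e$ and $\alpha(e)$ have the same color, then $\alpha$ is color permuting, i.e. $\alpha$ permutes the set $\{\mathcal{R},\mathcal{B},\mathcal{G}\}$ (whenever two edges have the same color, so do their images).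
   Context: $\mathrm{Cay}(G;S)$ has vertex set $G$ and edges $\{g,gs\}$, $g\in G$, $s\in S$. This Cayley graph is isomorphic to the honeycomb toroidal graph $\mathrm{HTG}(m,n,\ell)$. -}

module Defs where

open import Data.Nat using (ℕ; _+_; _/_)
open import Data.Bool using (Bool; true; false; not)
open import Data.List using (List; []; _∷_; _++_; replicate)
open import Data.Product using (_×_; _,_; Σ; ∃)
open import Data.Sum using (_⊎_)
open import Relation.Nullary using (¬_)

data Gen : Set where
  t x y : Gen

-- A letter is a generator together with an exponent sign (false = +1, true = -1).
Letter : Set
Letter = Gen × Bool

inv : Letter → Letter
inv (g , b) = (g , not b)

Word : Set
Word = List Letter

-- Group multiplication is concatenation _++_.
module Pres (m n ℓ : ℕ) where

  half-n : ℕ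
  half-n = n / 2

  c : ℕ
  c = (ℓ + m) / 2

  T X Y X⁻¹ Y⁻¹ : Letter
  T = (t , false)
  X = (x , false)
  Y = (y , false)
  X⁻¹ = (x , true)
  Y⁻¹ = (y , true)

  data Relator : Word → Set where
    r-t²   : Relator (T ∷ T ∷ [])
    r-x    : Relator (replicate half-n X)
    r-ym   : Relator (replicate m Y ++ replicate c X⁻¹)
    r-txt  : Relator (T ∷ X ∷ T ∷ X ∷ [])
    r-tyt  : Relator (T ∷ Y ∷ T ∷ Y ∷ [])
    r-xy   : Relator (X ∷ Y ∷ X⁻¹ ∷ Y⁻¹ ∷ [])

  data Base : Word → Word → Set where
    cancel : ∀ l → Base (l ∷ inv l ∷ []) []
    relator : ∀ {r} → Relator r → Base r []

  infix 4 _≈_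
  data _≈_ : Word → Word → Set where
    ≈-refl  : ∀ {u} → u ≈ u
    ≈-sym   : ∀ {u v} → u ≈ v → v ≈ u
    ≈-trans : ∀ {u v w} → u ≈ v → v ≈ w → u ≈ w
    ≈-step  : ∀ p q {u v} → Base u v → (p ++ u ++ q) ≈ (p ++ v ++ q)

  data Colour : Set where
    red blue green : Colour

  conn : Colour → Word
  conn red   = T ∷ []
  conn blue  = T ∷ X ∷ []
  conn green = T ∷ Y ∷ []

  HasColour : Colour → Word → Word → Set
  HasColour col g h = (h ≈ g ++ conn col) ⊎ (g ≈ h ++ conn col)

  Adj : Word → Word → Set
  Adj g h = Σ Colour λ col → HasColour col g h

  record IsAut (α : Word → Word) : Set where
    field
      resp      : ∀ {g h} → g ≈ h → α g ≈ α h
      injective : ∀ {g h} → α g ≈ α h → g ≈ h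
      surjective : ∀ h → ∃ λ g → α g ≈ h
      adj-pres  : ∀ {g h} → Adj g h → Adj (α g) (α h)
      adj-refl  : ∀ {g h} → Adj (α g) (α h) → Adj g h

  NoColourFixed : (Word → Word) → Set
  NoColourFixed α = ∀ col g h → HasColour col g h → ¬ HasColour col (α g) (α h)

  ColourPermuting : (Word → Word) → Set
  ColourPermuting α =
    ∀ col col' g h g' h' →
      HasColour col g h → HasColour col g' h' →
      HasColour col' (α g) (α h) → HasColour col' (α g') (α h')

{-# OPTIONS --safe #-}
module Submission where

open import Defs
open import Data.Nat using (ℕ; _+_; _≤_; _<_)
open import Data.Nat.Divisibility using (_∣_)
open import Data.Bool using (true; false)
open import Data.Bool.Properties using (not-involutive)
open import Data.List using (List; []; _∷_; _++_; concatMap)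
open import Data.List.Properties using (++-assoc; ++-identityʳ)
open import Data.Product using (_,_; ∃; ∃₂)
open import Data.Sum using (_⊎_; inj₁; inj₂; map₂; swap)
open import Data.Empty using (⊥-elim)
open import Function using (_∘_)
open import Relation.Nullary using (¬_)
open import Level using (0ℓ)
open import Relation.Binary.Bundles using (Setoid)
open import Relation.Binary.PropositionalEquality using (_≡_; refl; cong)
import Relation.Binary.Reasoning.Setoid as SetoidReasoning

-- Write σ_g(c) = z when α maps the c-coloured edge at g to the z-coloured edge
-- at α(g).  As α is a graph automorphism fixing no colour, every σ_g is a
-- derangement of the three colours, i.e. one of the two 3-cycles, and these
-- differ at every colour.  The edge {g, gd} has colour d at both ends and is
-- mapped to one edge, so σ_g(d) = σ_gd(d), whence σ_g = σ_gd.  The connection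
-- elements t, tx, ty generate G, so σ_g does not depend on g.
--
-- Telling t, tx, ty apart in G would need a model of G, so colours are only
-- compared up to conn a ≈ conn b and derangements are taken up to an equivalence.

record IsDerangement {A : Set} (_≃_ : A → A → Set) (P : A → A → Set) : Set where
  field
    total            : ∀ a → ∃ (P a)
    surjective       : ∀ z → ∃ λ a → P a z
    injective        : ∀ {a b z} → P a z → P b z → a ≃ b
    respˡ            : ∀ {a b z} → a ≃ b → P a z → P b z
    fixed-point-free : ∀ {a} → ¬ P a a

Covers : {A : Set} → A → A → A → Set
Covers d c e = ∀ a → a ≡ d ⊎ a ≡ c ⊎ a ≡ e

module _ {A : Set} {_≃_ : A → A → Set} {P Q : A → A → Set}
         (P-der : IsDerangement _≃_ P) (Q-der : IsDerangement _≃_ Q) {d : A}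
         (P⇒Q : ∀ {z} → P d z → Q d z) (Q⇒P : ∀ {z} → Q d z → P d z) where

  private
    module P = IsDerangement P-der
    module Q = IsDerangement Q-der

    module Beside {c e : A} (cover : Covers d c e) where

      via-Pdc : P c d → Q e d → P d c → Q c d
      via-Pdc Pcd Qed Pdc with P.total e
      ... | e′ , Pee′ with cover e′
      ...   | inj₁ refl        = Q.respˡ (P.injective Pee′ Pcd) Qed
      ...   | inj₂ (inj₁ refl) = ⊥-elim (Q.fixed-point-free (Q.respˡ (P.injective Pee′ Pdc) Qed))
      ...   | inj₂ (inj₂ refl) = ⊥-elim (P.fixed-point-free Pee′)

      via-Pde : P c d → P d e → Q c d
      via-Pde Pcd Pde with Q.total c
      ... | w , Qcw with cover w
      ...   | inj₁ refl        = Qcw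
      ...   | inj₂ (inj₁ refl) = ⊥-elim (Q.fixed-point-free Qcw)
      ...   | inj₂ (inj₂ refl) = ⊥-elim (P.fixed-point-free (P.respˡ (Q.injective Qcw (P⇒Q Pde)) Pcd))

      to-d : P c d → Q e d → Q c d
      to-d Pcd Qed with P.total d
      ... | d′ , Pdd′ with cover d′
      ...   | inj₁ refl        = ⊥-elim (P.fixed-point-free Pdd′)
      ...   | inj₂ (inj₁ refl) = via-Pdc Pcd Qed Pdd′
      ...   | inj₂ (inj₂ refl) = via-Pde Pcd Pdd′

      from-e : ∀ {z} → z ≡ d ⊎ z ≡ c ⊎ z ≡ e → P c z → Q e z → Q c z
      from-e (inj₁ refl)        Pcd Qed = to-d Pcd Qed
      from-e (inj₂ (inj₁ refl)) Pcc _   = ⊥-elim (P.fixed-point-free Pcc)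
      from-e (inj₂ (inj₂ refl)) _   Qee = ⊥-elim (Q.fixed-point-free Qee)

      agree-beside : ∀ {z} → P c z → Q c z
      agree-beside {z} Pcz with Q.surjective z
      ... | k , Qkz with cover k
      ...   | inj₁ refl        = Q.respˡ (P.injective (Q⇒P Qkz) Pcz) Qkz
      ...   | inj₂ (inj₁ refl) = Qkz
      ...   | inj₂ (inj₂ refl) = from-e (cover z) Pcz Qkz

  derangements-agree : ∀ {c e} → Covers d c e → ∀ {a z} → P a z → Q a z
  derangements-agree cover {a} Paz with cover a
  ... | inj₁ refl        = P⇒Q Paz
  ... | inj₂ (inj₁ refl) = Beside.agree-beside cover Paz
  ... | inj₂ (inj₂ refl) = Beside.agree-beside (map₂ swap ∘ cover) Paz

module Cayley (m n ℓ : ℕ) where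
  open Pres m n ℓ

  ≡⇒≈ : ∀ {u v} → u ≡ v → u ≈ v
  ≡⇒≈ refl = ≈-refl

  word-setoid : Setoid 0ℓ 0ℓ
  word-setoid = record
    { Carrier = Word
    ; _≈_ = _≈_
    ; isEquivalence = record { refl = ≈-refl ; sym = ≈-sym ; trans = ≈-trans }
    }

  open SetoidReasoning word-setoid

  ++-congˡ : ∀ p {u v} → u ≈ v → p ++ u ≈ p ++ v
  ++-congˡ p ≈-refl        = ≈-refl
  ++-congˡ p (≈-sym e)     = ≈-sym (++-congˡ p e)
  ++-congˡ p (≈-trans e f) = ≈-trans (++-congˡ p e) (++-congˡ p f)
  ++-congˡ p (≈-step p′ q {u} {v} b) = begin
    p ++ p′ ++ u ++ q    ≡⟨ ++-assoc p p′ (u ++ q) ⟨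
    (p ++ p′) ++ u ++ q  ≈⟨ ≈-step (p ++ p′) q b ⟩
    (p ++ p′) ++ v ++ q  ≡⟨ ++-assoc p p′ (v ++ q) ⟩
    p ++ p′ ++ v ++ q    ∎

  ++-congʳ : ∀ r {u v} → u ≈ v → u ++ r ≈ v ++ r
  ++-congʳ r ≈-refl        = ≈-refl
  ++-congʳ r (≈-sym e)     = ≈-sym (++-congʳ r e)
  ++-congʳ r (≈-trans e f) = ≈-trans (++-congʳ r e) (++-congʳ r f)
  ++-congʳ r (≈-step p q {u} {v} b) = begin
    (p ++ u ++ q) ++ r  ≡⟨ reassoc u ⟩
    p ++ u ++ q ++ r    ≈⟨ ≈-step p (q ++ r) b ⟩
    p ++ v ++ q ++ r    ≡⟨ reassoc v ⟨
    (p ++ v ++ q) ++ r  ∎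
    where
    reassoc : ∀ w → (p ++ w ++ q) ++ r ≡ p ++ w ++ q ++ r
    reassoc w rewrite ++-assoc p (w ++ q) r | ++-assoc w q r = refl

  infix 8 _⁻¹
  _⁻¹ : Word → Word
  [] ⁻¹      = []
  (l ∷ w) ⁻¹ = w ⁻¹ ++ inv l ∷ []

  inv-involutive : ∀ l → inv (inv l) ≡ l
  inv-involutive (g , b) = cong (g ,_) (not-involutive b)

  ⁻¹-inverseˡ : ∀ w → w ⁻¹ ++ w ≈ []
  ⁻¹-inverseˡ []      = ≈-refl
  ⁻¹-inverseˡ (l ∷ w) = begin
    (w ⁻¹ ++ inv l ∷ []) ++ l ∷ w  ≡⟨ ++-assoc (w ⁻¹) (inv l ∷ []) (l ∷ w) ⟩
    w ⁻¹ ++ inv l ∷ l ∷ w          ≡⟨ cong (λ k → w ⁻¹ ++ inv l ∷ k ∷ w) (inv-involutive l) ⟨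
    w ⁻¹ ++ inv l ∷ inv (inv l) ∷ w ≈⟨ ≈-step (w ⁻¹) w (cancel (inv l)) ⟩
    w ⁻¹ ++ w                      ≈⟨ ⁻¹-inverseˡ w ⟩
    []                             ∎

  ⁻¹-inverseʳ : ∀ w → w ++ w ⁻¹ ≈ []
  ⁻¹-inverseʳ []      = ≈-refl
  ⁻¹-inverseʳ (l ∷ w) = begin
    l ∷ w ++ w ⁻¹ ++ inv l ∷ []    ≡⟨ cong (l ∷_) (++-assoc w (w ⁻¹) (inv l ∷ [])) ⟨
    l ∷ (w ++ w ⁻¹) ++ inv l ∷ []  ≈⟨ ++-congˡ (l ∷ []) (++-congʳ (inv l ∷ []) (⁻¹-inverseʳ w)) ⟩
    l ∷ inv l ∷ []                 ≈⟨ ≈-step [] [] (cancel l) ⟩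
    []                             ∎

  ++-cancelˡ : ∀ g {u v} → g ++ u ≈ g ++ v → u ≈ v
  ++-cancelˡ g {u} {v} e = begin
    u                 ≈⟨ ++-congʳ u (⁻¹-inverseˡ g) ⟨
    (g ⁻¹ ++ g) ++ u  ≡⟨ ++-assoc (g ⁻¹) g u ⟩
    g ⁻¹ ++ g ++ u    ≈⟨ ++-congˡ (g ⁻¹) e ⟩
    g ⁻¹ ++ g ++ v    ≡⟨ ++-assoc (g ⁻¹) g v ⟨
    (g ⁻¹ ++ g) ++ v  ≈⟨ ++-congʳ v (⁻¹-inverseˡ g) ⟩
    v                 ∎

  conn-involutive : ∀ c → conn c ++ conn c ≈ []
  conn-involutive red   = ≈-step [] [] (relator r-t²)
  conn-involutive blue  = ≈-step [] [] (relator r-txt)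
  conn-involutive green = ≈-step [] [] (relator r-tyt)

  ++-conn-involutive : ∀ g c → (g ++ conn c) ++ conn c ≈ g
  ++-conn-involutive g c = begin
    (g ++ conn c) ++ conn c  ≡⟨ ++-assoc g (conn c) (conn c) ⟩
    g ++ conn c ++ conn c    ≈⟨ ++-congˡ g (conn-involutive c) ⟩
    g ++ []                  ≡⟨ ++-identityʳ g ⟩
    g                        ∎

  swap-conn : ∀ {g h} c → g ≈ h ++ conn c → h ≈ g ++ conn c
  swap-conn {g} {h} c e = begin
    h                        ≈⟨ ++-conn-involutive h c ⟨
    (h ++ conn c) ++ conn c  ≈⟨ ++-congʳ (conn c) e ⟨
    g ++ conn c              ∎

  hasColour⇒≈ : ∀ {col g h} → HasColour col g h → h ≈ g ++ conn col
  hasColour⇒≈       (inj₁ e) = e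
  hasColour⇒≈ {col} (inj₂ e) = swap-conn col e

  connections : Letter → List Colour
  connections (t , _)     = red ∷ []
  connections (x , false) = red ∷ blue ∷ []
  connections (x , true)  = blue ∷ red ∷ []
  connections (y , false) = red ∷ green ∷ []
  connections (y , true)  = green ∷ red ∷ []

  letter≈connections : ∀ l → l ∷ [] ≈ concatMap conn (connections l)
  letter≈connections (t , false) = ≈-refl
  letter≈connections (t , true)  = begin
    (t , true) ∷ []          ≈⟨ ≈-step [] ((t , true) ∷ []) (relator r-t²) ⟨
    T ∷ T ∷ (t , true) ∷ []  ≈⟨ ≈-step (T ∷ []) [] (cancel T) ⟩
    T ∷ []                   ∎
  letter≈connections (x , false) = ≈-sym (≈-step [] (X ∷ []) (relator r-t²))
  letter≈connections (x , true)  = begin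
    X⁻¹ ∷ []               ≈⟨ ≈-step [] (X⁻¹ ∷ []) (relator r-txt) ⟨
    T ∷ X ∷ T ∷ X ∷ X⁻¹ ∷ [] ≈⟨ ≈-step (T ∷ X ∷ T ∷ []) [] (cancel X) ⟩
    T ∷ X ∷ T ∷ []         ∎
  letter≈connections (y , false) = ≈-sym (≈-step [] (Y ∷ []) (relator r-t²))
  letter≈connections (y , true)  = begin
    Y⁻¹ ∷ []               ≈⟨ ≈-step [] (Y⁻¹ ∷ []) (relator r-tyt) ⟨
    T ∷ Y ∷ T ∷ Y ∷ Y⁻¹ ∷ [] ≈⟨ ≈-step (T ∷ Y ∷ T ∷ []) [] (cancel Y) ⟩
    T ∷ Y ∷ T ∷ []         ∎

  colours-besides : ∀ (d : Colour) → ∃₂ λ c e → Covers d c e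
  colours-besides red   = blue , green , λ { red → inj₁ refl ; blue → inj₂ (inj₁ refl) ; green → inj₂ (inj₂ refl) }
  colours-besides blue  = red , green , λ { blue → inj₁ refl ; red → inj₂ (inj₁ refl) ; green → inj₂ (inj₂ refl) }
  colours-besides green = red , blue , λ { green → inj₁ refl ; red → inj₂ (inj₁ refl) ; blue → inj₂ (inj₂ refl) }

  module _ {α : Word → Word} (aut : IsAut α) (no-fixed : NoColourFixed α) where
    open IsAut aut

    ColourMap : Word → Colour → Colour → Set
    ColourMap g c z = α (g ++ conn c) ≈ α g ++ conn z

    colourMap-derangement : ∀ g → IsDerangement (λ a b → conn a ≈ conn b) (ColourMap g)
    colourMap-derangement g = record
      { total            = total
      ; surjective       = surjective′
      ; injective        = λ e f → ++-cancelˡ g (injective (≈-trans e (≈-sym f)))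
      ; respˡ            = λ e f → ≈-trans (resp (++-congˡ g (≈-sym e))) f
      ; fixed-point-free = λ {a} e → no-fixed a g (g ++ conn a) (inj₁ ≈-refl) (inj₁ e)
      }
      where
      total : ∀ a → ∃ (ColourMap g a)
      total a with adj-pres {g} {g ++ conn a} (a , inj₁ ≈-refl)
      ... | z , H = z , hasColour⇒≈ H

      surjective′ : ∀ z → ∃ λ a → ColourMap g a z
      surjective′ z with surjective (α g ++ conn z)
      ... | k , αk≈ with adj-refl {g} {k} (z , inj₁ αk≈)
      ...   | a , H = a , ≈-trans (resp (≈-sym (hasColour⇒≈ H))) αk≈

    colourMap-resp : ∀ {g g′ c z} → g ≈ g′ → ColourMap g c z → ColourMap g′ c z
    colourMap-resp {g} {g′} {c} {z} e f = begin
      α (g′ ++ conn c)  ≈⟨ resp (++-congʳ (conn c) e) ⟨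
      α (g ++ conn c)   ≈⟨ f ⟩
      α g ++ conn z     ≈⟨ ++-congʳ (conn z) (resp e) ⟩
      α g′ ++ conn z    ∎

    colourMap-across : ∀ {g d z} → ColourMap g d z → ColourMap (g ++ conn d) d z
    colourMap-across {g} {d} {z} f = ≈-trans (resp (++-conn-involutive g d)) (swap-conn z f)

    colourMap-step : ∀ g d {c z} → ColourMap g c z → ColourMap (g ++ conn d) c z
    colourMap-step g d with colours-besides d
    ... | _ , _ , cover =
      derangements-agree (colourMap-derangement g) (colourMap-derangement (g ++ conn d))
        colourMap-across
        (colourMap-resp (++-conn-involutive g d) ∘ colourMap-across)
        cover

    colourMap-connections : ∀ cs g {c z} → ColourMap g c z → ColourMap (g ++ concatMap conn cs) c z
    colourMap-connections []       g f = colourMap-resp (≈-sym (≡⇒≈ (++-identityʳ g))) f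
    colourMap-connections (d ∷ cs) g f =
      colourMap-resp (≡⇒≈ (++-assoc g (conn d) (concatMap conn cs)))
        (colourMap-connections cs (g ++ conn d) (colourMap-step g d f))

    colourMap-word : ∀ w g {c z} → ColourMap g c z → ColourMap (g ++ w) c z
    colourMap-word []      g f = colourMap-resp (≈-sym (≡⇒≈ (++-identityʳ g))) f
    colourMap-word (l ∷ w) g f =
      colourMap-resp (≡⇒≈ (++-assoc g (l ∷ []) w))
        (colourMap-word w (g ++ l ∷ [])
          (colourMap-resp (++-congˡ g (≈-sym (letter≈connections l)))
            (colourMap-connections (connections l) g f)))

    colourMap-constant : ∀ g h {c z} → ColourMap g c z → ColourMap h c z
    colourMap-constant g h f = colourMap-resp g⋯h≈h (colourMap-word (g ⁻¹ ++ h) g f)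
      where
      g⋯h≈h : g ++ g ⁻¹ ++ h ≈ h
      g⋯h≈h = begin
        g ++ g ⁻¹ ++ h    ≡⟨ ++-assoc g (g ⁻¹) h ⟨
        (g ++ g ⁻¹) ++ h  ≈⟨ ++-congʳ h (⁻¹-inverseʳ g) ⟩
        h                 ∎

    colour-permuting : ColourPermuting α
    colour-permuting col col′ g h g′ h′ gh g′h′ αgαh = inj₁ (begin
      α h′                ≈⟨ resp (hasColour⇒≈ g′h′) ⟩
      α (g′ ++ conn col)  ≈⟨ colourMap-constant g g′ σ ⟩
      α g′ ++ conn col′   ∎)
      where
      σ : ColourMap g col col′
      σ = ≈-trans (resp (≈-sym (hasColour⇒≈ gh))) (hasColour⇒≈ αgαh)

lemma5p1 : (m n ℓ : ℕ) → 1 ≤ m → 4 ≤ n → 2 ∣ n → ℓ < n → 2 ∣ (ℓ + m) →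
    (α : Word → Word) → Pres.IsAut m n ℓ α → Pres.NoColourFixed m n ℓ α →
    Pres.ColourPermuting m n ℓ α
lemma5p1 m n ℓ _ _ _ _ _ α aut no-fixed = Cayley.colour-permuting m n ℓ aut no-fixed
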